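{- Let $f\colon\mathbb{N}\to\mathbb{C}$ (with $\mathbb{N}=\{0,1,2,\ldots\}$). Define for $n\in\mathbb{N}$: $S_f(n)=\sum_{k=0}^{n-1} f(k)$ and $T_p(n)=\sum_{k=0}^{n-1} f(3k+p)$ for $p\in\{0,1,2\}$. Let $T_0^+\colon\{\tfrac{0}{3},\tfrac13,\tfrac23,\tfrac33,\ldots\}\to\mathbb{C}$ be any function with $T_0^+(n)=T_0(n)$ for all $n\in\mathbb{N}$. Then the following are equivalent: (i) $T_0^+(\frac{n}{3})+T_0^+(\frac{n+1}{3})+T_0^+(\frac{n+2}{3})-S_f(n)$ is constant on $\mathbb{N}$; (ii) for each $p\in\{1,2\}$ and all $n\in\mathbb{N}$, $T_0^+(n+1+\frac{p}{3})-T_0^+(n+\frac{p}{3})=f(3n+p)$; (iii) for each $p\in\{1,2\}$, $T_0^+(n+\frac{p}{3})-T_p(n)$ is constant on $\mathbb{N}$.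
   Context: Empty sums are $0$. -}

module Defs where

open import Level using (Level; _⊔_)
open import Data.Nat using (ℕ; zero; suc; _+_; _*_; _≤_)
open import Data.Product using (Σ)
open import Algebra.Bundles using (AbelianGroup)

-- Complex numbers are not available in agda-stdlib; the statement only uses
-- addition/subtraction of values, so we work in an arbitrary abelian group G
-- (ℂ under + being one instance).
module _ {c ℓ : Level} (G : AbelianGroup c ℓ) where
  open AbelianGroup G

  sumTo : (ℕ → Carrier) → ℕ → Carrier
  sumTo f zero    = ε
  sumTo f (suc n) = sumTo f n ∙ f n

  S : (ℕ → Carrier) → ℕ → Carrier
  S f = sumTo f

  T : (ℕ → Carrier) → ℕ → ℕ → Carrier
  T f p = sumTo (λ k → f (3 * k + p))

  -- A function T₀⁺ on {0/3, 1/3, 2/3, ...} is encoded as  U : ℕ → Carrier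
  -- with  U m = T₀⁺(m/3).  Extension condition: T₀⁺(n) = T₀(n), i.e. U (3n) ≈ T₀(n).
  Extends : (ℕ → Carrier) → (ℕ → Carrier) → Set ℓ
  Extends f U = ∀ n → U (3 * n) ≈ T f 0 n

  CondI : (ℕ → Carrier) → (ℕ → Carrier) → Set (c ⊔ ℓ)
  CondI f U = Σ Carrier λ C → ∀ n →
    ((U n ∙ U (n + 1)) ∙ U (n + 2)) ∙ (S f n) ⁻¹ ≈ C

  CondII : (ℕ → Carrier) → (ℕ → Carrier) → Set ℓ
  CondII f U = ∀ p → 1 ≤ p → p ≤ 2 → ∀ n →
    U (3 * (n + 1) + p) ∙ (U (3 * n + p)) ⁻¹ ≈ f (3 * n + p)

  CondIII : (ℕ → Carrier) → (ℕ → Carrier) → Set (c ⊔ ℓ)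
  CondIII f U = ∀ p → 1 ≤ p → p ≤ 2 → Σ Carrier λ C → ∀ n →
    U (3 * n + p) ∙ (T f p n) ⁻¹ ≈ C

-- Everything reduces to the shift equation T₀⁺(x + 1) − T₀⁺(x) = f(3x) for x ∈ ℕ/3.
-- A sequence minus a partial-sum sequence is constant exactly when its increments
-- are the summands.  The increments of the three-term window in (i) are
-- T₀⁺((n + 3)/3) − T₀⁺(n/3), so (i) is the shift equation; applied to
-- T₀⁺(n + p/3) − T_p(n) the same fact turns (iii) into (ii).  Splitting by the
-- residue p of 3x modulo 3, the classes p = 1, 2 are (ii), while p = 0 holds anyway
-- because T₀⁺ extends T₀.
module Submission where

open import Defs
open import Data.Nat using (ℕ)
open import Data.Product using (_×_)
open import Function.Bundles using (_⇔_)
open import Algebra.Bundles using (AbelianGroup)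

open import Level using (Level; _⊔_)
open import Data.Nat using (zero; suc; _+_; _*_; _≤_; s≤s; z≤n; NonZero)
open import Data.Nat.Properties using (+-comm; +-suc; +-identityʳ; *-comm)
open import Data.Nat.DivMod using (_divMod_; result)
open import Data.Nat.Tactic.RingSolver using (solve-∀)
open import Data.Fin using (Fin; toℕ; zero; suc)
open import Data.Product using (Σ; _,_)
open import Function.Bundles using (mk⇔; Equivalence)
open import Function.Properties.Equivalence using () renaming (trans to ⇔-trans)
open import Function.Construct.Symmetry using (⇔-sym)
open import Relation.Binary.PropositionalEquality as ≡ using (_≡_)
import Algebra.Properties.AbelianGroup as AbelianGroupProperties
import Algebra.Properties.CommutativeSemigroup as CommutativeSemigroupProperties
import Relation.Binary.Reasoning.Setoid as SetoidReasoning

divMod-elim : ∀ {p} (d : ℕ) .{{_ : NonZero d}} (P : ℕ → Set p) →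
              (∀ q (r : Fin d) → P (d * q + toℕ r)) → ∀ n → P n
divMod-elim d P h n with n divMod d
... | result q r n≡r+q*d = ≡.subst P d*q+r≡n (h q r)
  where
  d*q+r≡n : d * q + toℕ r ≡ n
  d*q+r≡n = ≡.sym (≡.trans n≡r+q*d
    (≡.trans (+-comm (toℕ r) (q * d)) (≡.cong (_+ toℕ r) (*-comm q d))))

∀-cong-⇔ : ∀ {a p q} {A : Set a} {P : A → Set p} {Q : A → Set q} →
           (∀ x → P x ⇔ Q x) → (∀ x → P x) ⇔ (∀ x → Q x)
∀-cong-⇔ P⇔Q = mk⇔
  (λ P x → Equivalence.to (P⇔Q x) (P x))
  (λ Q x → Equivalence.from (P⇔Q x) (Q x))

module Increments {c ℓ : Level} (G : AbelianGroup c ℓ) where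
  open AbelianGroup G
  open AbelianGroupProperties G using (//-rightDividesˡ; //-rightDividesʳ; //-cong₂; xyx⁻¹≈y)
  open CommutativeSemigroupProperties commutativeSemigroup using (xy∙z≈xz∙y)
  open SetoidReasoning setoid

  ≡⇒≈ : ∀ {x y} → x ≡ y → x ≈ y
  ≡⇒≈ ≡.refl = refl

  ≈-resp-⇔ : ∀ {x x′ y y′} → x ≈ x′ → y ≈ y′ → (x ≈ y ⇔ x′ ≈ y′)
  ≈-resp-⇔ x≈x′ y≈y′ = mk⇔
    (λ x≈y → trans (sym x≈x′) (trans x≈y y≈y′))
    (λ x′≈y′ → trans x≈x′ (trans x′≈y′ (sym y≈y′)))

  -≈⇔≈∙ : ∀ {x y z} → x - y ≈ z ⇔ x ≈ z ∙ y
  -≈⇔≈∙ {x} {y} {z} = mk⇔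
    (λ x-y≈z → begin
      x           ≈⟨ //-rightDividesˡ y x ⟨
      (x - y) ∙ y ≈⟨ ∙-congʳ x-y≈z ⟩
      z ∙ y       ∎)
    (λ x≈z∙y → begin
      x - y     ≈⟨ ∙-congʳ x≈z∙y ⟩
      z ∙ y - y ≈⟨ //-rightDividesʳ y z ⟩
      z         ∎)

  -≈-swap : ∀ {x y z w} → x - y ≈ z - w → x - z ≈ y - w
  -≈-swap {x} {y} {z} {w} x-y≈z-w = Equivalence.from -≈⇔≈∙ (begin
    x             ≈⟨ Equivalence.to -≈⇔≈∙ x-y≈z-w ⟩
    z ∙ w ⁻¹ ∙ y  ≈⟨ xy∙z≈xz∙y z (w ⁻¹) y ⟩
    z ∙ y ∙ w ⁻¹  ≈⟨ ∙-congʳ (comm z y) ⟩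
    y ∙ z ∙ w ⁻¹  ≈⟨ xy∙z≈xz∙y y z (w ⁻¹) ⟩
    y ∙ w ⁻¹ ∙ z  ∎)

  Δ : (ℕ → Carrier) → ℕ → Carrier
  Δ a n = a (suc n) - a n

  Constant : (ℕ → Carrier) → Set (c ⊔ ℓ)
  Constant g = Σ Carrier λ C → ∀ n → g n ≈ C

  constant⇔stationary : ∀ (g : ℕ → Carrier) → Constant g ⇔ (∀ n → g (suc n) ≈ g n)
  constant⇔stationary g = mk⇔
    (λ (C , g≈C) n → trans (g≈C (suc n)) (sym (g≈C n)))
    (λ stationary → g 0 , g≈g0 stationary)
    where
    g≈g0 : (∀ n → g (suc n) ≈ g n) → ∀ n → g n ≈ g 0
    g≈g0 stationary zero    = refl
    g≈g0 stationary (suc n) = trans (stationary n) (g≈g0 stationary n)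

  constant-difference⇔Δ≈Δ : ∀ (a b : ℕ → Carrier) →
                            Constant (λ n → a n - b n) ⇔ (∀ n → Δ a n ≈ Δ b n)
  constant-difference⇔Δ≈Δ a b = ⇔-trans
    (constant⇔stationary (λ n → a n - b n))
    (∀-cong-⇔ λ n → mk⇔ -≈-swap -≈-swap)

  Δ-cong : ∀ {a b : ℕ → Carrier} → (∀ n → a n ≈ b n) → ∀ n → Δ a n ≈ Δ b n
  Δ-cong a≈b n = //-cong₂ (a≈b (suc n)) (a≈b n)

  Δ-sumTo : ∀ (d : ℕ → Carrier) n → Δ (sumTo G d) n ≈ d n
  Δ-sumTo d n = xyx⁻¹≈y (sumTo G d n) (d n)

  window : (ℕ → Carrier) → ℕ → Carrier
  window u n = u n ∙ u (n + 1) ∙ u (n + 2)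

  y∙z∙w-x∙y∙z≈w-x : ∀ x y z w → y ∙ z ∙ w - (x ∙ y ∙ z) ≈ w - x
  y∙z∙w-x∙y∙z≈w-x x y z w = Equivalence.from -≈⇔≈∙ (begin
    y ∙ z ∙ w                ≈⟨ comm (y ∙ z) w ⟩
    w ∙ (y ∙ z)              ≈⟨ ∙-congʳ (//-rightDividesˡ x w) ⟨
    (w - x) ∙ x ∙ (y ∙ z)    ≈⟨ assoc (w - x) x (y ∙ z) ⟩
    (w - x) ∙ (x ∙ (y ∙ z))  ≈⟨ ∙-congˡ (assoc x y z) ⟨
    (w - x) ∙ (x ∙ y ∙ z)    ∎)

  Δ-window : ∀ (u : ℕ → Carrier) n → Δ (window u) n ≈ u (n + 3) - u n
  Δ-window u n = begin
    window u (suc n) - window u n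
      ≡⟨ ≡.cong (_- window u n) window-suc ⟩
    u (n + 1) ∙ u (n + 2) ∙ u (n + 3) - window u n
      ≈⟨ y∙z∙w-x∙y∙z≈w-x (u n) (u (n + 1)) (u (n + 2)) (u (n + 3)) ⟩
    u (n + 3) - u n ∎
    where
    window-suc : window u (suc n) ≡ u (n + 1) ∙ u (n + 2) ∙ u (n + 3)
    window-suc = ≡.cong₂ _∙_
      (≡.cong₂ _∙_ (≡.cong u (+-comm 1 n)) (≡.cong u (≡.sym (+-suc n 1))))
      (≡.cong u (≡.sym (+-suc n 2)))

module Conditions {c ℓ : Level} (G : AbelianGroup c ℓ) (f U : ℕ → AbelianGroup.Carrier G) where
  open AbelianGroup G
  open Increments G
  open SetoidReasoning setoid

  -- With U m = T₀⁺(m/3) this is T₀⁺(x + 1) − T₀⁺(x) = f(3x) at x = m/3.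
  ShiftEquationAt : ℕ → Set ℓ
  ShiftEquationAt m = U (m + 3) - U m ≈ f m

  ShiftEquation : Set ℓ
  ShiftEquation = ∀ m → ShiftEquationAt m

  ResidueShiftEquation : ℕ → Set ℓ
  ResidueShiftEquation p = ∀ q → ShiftEquationAt (3 * q + p)

  NonzeroResidueShiftEquations : Set ℓ
  NonzeroResidueShiftEquations = ∀ p → 1 ≤ p → p ≤ 2 → ResidueShiftEquation p

  Δ-residue : ∀ p q → Δ (λ k → U (3 * k + p)) q ≡ U (3 * q + p + 3) - U (3 * q + p)
  Δ-residue p q = ≡.cong (λ i → U i - U (3 * q + p)) (index q p)
    where
    index : ∀ q p → 3 * suc q + p ≡ 3 * q + p + 3
    index = solve-∀

  condI⇔shiftEquation : CondI G f U ⇔ ShiftEquation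
  condI⇔shiftEquation = ⇔-trans
    (constant-difference⇔Δ≈Δ (window U) (sumTo G f))
    (∀-cong-⇔ λ m → ≈-resp-⇔ (Δ-window U m) (Δ-sumTo f m))

  condII⇔nonzeroResidues : CondII G f U ⇔ NonzeroResidueShiftEquations
  condII⇔nonzeroResidues =
    ∀-cong-⇔ λ p → ∀-cong-⇔ λ _ → ∀-cong-⇔ λ _ → ∀-cong-⇔ λ q →
      ≈-resp-⇔ (≡⇒≈ (≡.cong (λ i → U i - U (3 * q + p)) (index q p))) refl
    where
    index : ∀ q p → 3 * (q + 1) + p ≡ 3 * q + p + 3
    index = solve-∀

  condIII⇔nonzeroResidues : CondIII G f U ⇔ NonzeroResidueShiftEquations
  condIII⇔nonzeroResidues =
    ∀-cong-⇔ λ p → ∀-cong-⇔ λ _ → ∀-cong-⇔ λ _ → ⇔-trans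
      (constant-difference⇔Δ≈Δ (λ k → U (3 * k + p)) (T G f p))
      (∀-cong-⇔ λ q →
        ≈-resp-⇔ (≡⇒≈ (Δ-residue p q)) (Δ-sumTo (λ k → f (3 * k + p)) q))

  extends⇒residue0 : Extends G f U → ResidueShiftEquation 0
  extends⇒residue0 ext q = begin
    U (3 * q + 0 + 3) - U (3 * q + 0)  ≡⟨ Δ-residue 0 q ⟨
    Δ (λ k → U (3 * k + 0)) q          ≈⟨ Δ-cong U[3k+0]≈T₀ q ⟩
    Δ (T G f 0) q                      ≈⟨ Δ-sumTo (λ k → f (3 * k + 0)) q ⟩
    f (3 * q + 0)                      ∎
    where
    U[3k+0]≈T₀ : ∀ k → U (3 * k + 0) ≈ T G f 0 k
    U[3k+0]≈T₀ k = trans (≡⇒≈ (≡.cong U (+-identityʳ (3 * k)))) (ext k)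

  shiftEquation⇔nonzeroResidues : Extends G f U → ShiftEquation ⇔ NonzeroResidueShiftEquations
  shiftEquation⇔nonzeroResidues ext = mk⇔
    (λ shift p _ _ q → shift (3 * q + p))
    (λ residues → divMod-elim 3 ShiftEquationAt λ q r → residue residues r q)
    where
    residue : NonzeroResidueShiftEquations → ∀ (r : Fin 3) → ResidueShiftEquation (toℕ r)
    residue residues zero             = extends⇒residue0 ext
    residue residues (suc zero)       = residues 1 (s≤s z≤n) (s≤s z≤n)
    residue residues (suc (suc zero)) = residues 2 (s≤s z≤n) (s≤s (s≤s z≤n))

proposition3p8 : ∀ {c ℓ} (G : AbelianGroup c ℓ) (f U : ℕ → AbelianGroup.Carrier G) →
    Extends G f U →
    (CondI G f U ⇔ CondII G f U) × (CondII G f U ⇔ CondIII G f U)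
proposition3p8 G f U ext =
  ⇔-trans condI⇔shiftEquation
    (⇔-trans (shiftEquation⇔nonzeroResidues ext) (⇔-sym condII⇔nonzeroResidues)) ,
  ⇔-trans condII⇔nonzeroResidues (⇔-sym condIII⇔nonzeroResidues)
  where open Conditions G f U
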